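{- For every integer $\ell\ge4$, $Z_{\mathrm{zigzag}}(\ell)<T_{\mathrm{zigzag}}(\ell)$ and $Z_{\mathrm{ballot}}(\ell)<T_{\mathrm{ballot}}(\ell)$.
   Context: $A_n$ is the Euler zigzag number (OEIS A000111): the number of permutations $\sigma$ of $\{1,\dots,n\}$ with $\sigma_1<\sigma_2>\sigma_3<\cdots$. $\binom{M}{k_1,\dots,k_r}=M!/(k_1!\cdots k_r!)$ with $\sum k_j=M$; $C_n=\frac1{n+1}\binom{2n}{n}$; $\binom ab=0$ for $b<0$; empty products are $1$. For $\ell\ge4$ let $\beta_\ell=A_\ell\binom{2^{\ell}-3}{\ell}\binom{2^{\ell}-3-\ell}{2^{\ell-1}-2,\,2^{\ell-2}-2,\,2^{\ell-3}-1,\,2^{\ell-4}-1,\dots,2^1-1}$ and $\gamma_\ell=A_\ell\binom{2^{\ell}-5}{\ell}\binom{2^{\ell}-5-\ell}{2^{\ell-1}-3,\,2^{\ell-2}-3,\,2^{\ell-3}-1,\,2^{\ell-4}-1,\dots,2^1-1}$, and define $T_{\mathrm{zigzag}}(\ell)=10^{2^{\ell-4}}\beta_\ell\prod_{i=4}^{\ell-1}\beta_i^{2^{\ell-1-i}}$, $Z_{\mathrm{zigzag}}(\ell)=10^{2^{\ell-4}}\gamma_\ell\prod_{i=4}^{\ell-1}\beta_i^{2^{\ell-1-i}}$, $T_{\mathrm{ballot}}(\ell)=10^{2^{\ell-3}}\prod_{i=0}^{\ell-4}\left((2^{\ell-i}-4)C_{2^{\ell-i-1}-1}\right)^{2^i}$,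 $Z_{\mathrm{ballot}}(\ell)=(2^\ell-7)\left(\binom{2^\ell-6}{2^{\ell-1}-3}-\binom{2^\ell-6}{2^{\ell-1}-6}\right)10^{2^{\ell-3}}\prod_{i=0}^{\ell-5}\left((2^{\ell-1-i}-4)C_{2^{\ell-i-2}-1}\right)^{2^{i+1}}$. -}

module Defs where

open import Data.Nat using (ℕ; zero; suc; _+_; _*_; _∸_; _^_; _!; _<ᵇ_; NonZero)
open import Data.Nat.Properties using (_!≢0; m*n≢0)
open import Data.Nat.DivMod using (_/_)
open import Data.Nat.Combinatorics using (_C_)
open import Data.Bool using (Bool; true; false; _∧_)
open import Data.List using (List; []; _∷_; length; map; upTo; concatMap; filter)
open import Data.Integer as ℤ using (ℤ; +_)
open import Data.Nat.ListAction using (product)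

-- Euler zigzag numbers A_n (OEIS A000111), defined as the number of
-- permutations σ of {1,…,n} with σ₁ < σ₂ > σ₃ < ⋯ .

insertions : ℕ → List ℕ → List (List ℕ)
insertions x []       = (x ∷ []) ∷ []
insertions x (y ∷ ys) = (x ∷ y ∷ ys) ∷ map (y ∷_) (insertions x ys)

perms : List ℕ → List (List ℕ)
perms []       = [] ∷ []
perms (x ∷ xs) = concatMap (insertions x) (perms xs)

oneTo : ℕ → List ℕ
oneTo n = map suc (upTo n)

mutual
  upDown : List ℕ → Bool
  upDown (x ∷ y ∷ r) = (x <ᵇ y) ∧ downUp (y ∷ r)
  upDown _           = true

  downUp : List ℕ → Bool
  downUp (x ∷ y ∷ r) = (y <ᵇ x) ∧ upDown (y ∷ r)
  downUp _           = true

isUpDown : List ℕ → Bool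
isUpDown = upDown

countTrue : (List ℕ → Bool) → List (List ℕ) → ℕ
countTrue p []       = 0
countTrue p (x ∷ xs) with p x
... | true  = suc (countTrue p xs)
... | false = countTrue p xs

zigzag : ℕ → ℕ
zigzag n = countTrue isUpDown (perms (oneTo n))

-- Multinomial coefficient  M! / (k₁! ⋯ k_r!)  (used only with Σ kⱼ = M)

prodFact : List ℕ → ℕ
prodFact ks = product (map _! ks)

prodFact≢0 : ∀ ks → NonZero (prodFact ks)
prodFact≢0 []       = _
prodFact≢0 (k ∷ ks) = m*n≢0 (k !) (prodFact ks) {{k !≢0}} {{prodFact≢0 ks}}

multinomial : ℕ → List ℕ → ℕ
multinomial M ks = (M !  / prodFact ks) {{prodFact≢0 ks}}

catalan : ℕ → ℕ
catalan n = ((2 * n) C n) / suc n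

prodRange : ℕ → ℕ → (ℕ → ℕ) → ℕ
prodRange a b f = product (map (λ k → f (a + k)) (upTo (b ∸ a)))

-- β_ℓ and γ_ℓ  (meaningful for ℓ ≥ 4)

tailParts : ℕ → List ℕ
tailParts ℓ = map (λ j → 2 ^ (ℓ ∸ 3 ∸ j) ∸ 1) (upTo (ℓ ∸ 3))

β : ℕ → ℕ
β ℓ = zigzag ℓ * ((2 ^ ℓ ∸ 3) C ℓ)
      * multinomial (2 ^ ℓ ∸ 3 ∸ ℓ)
          ((2 ^ (ℓ ∸ 1) ∸ 2) ∷ (2 ^ (ℓ ∸ 2) ∸ 2) ∷ tailParts ℓ)

γ : ℕ → ℕ
γ ℓ = zigzag ℓ * ((2 ^ ℓ ∸ 5) C ℓ)
      * multinomial (2 ^ ℓ ∸ 5 ∸ ℓ)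
          ((2 ^ (ℓ ∸ 1) ∸ 3) ∷ (2 ^ (ℓ ∸ 2) ∸ 3) ∷ tailParts ℓ)

βprod : ℕ → ℕ
βprod ℓ = prodRange 4 ℓ (λ i → β i ^ (2 ^ (ℓ ∸ 1 ∸ i)))

Tzigzag : ℕ → ℕ
Tzigzag ℓ = 10 ^ (2 ^ (ℓ ∸ 4)) * β ℓ * βprod ℓ

Zzigzag : ℕ → ℕ
Zzigzag ℓ = 10 ^ (2 ^ (ℓ ∸ 4)) * γ ℓ * βprod ℓ

Tballot : ℕ → ℕ
Tballot ℓ = 10 ^ (2 ^ (ℓ ∸ 3))
  * prodRange 0 (ℓ ∸ 3)
      (λ i → ((2 ^ (ℓ ∸ i) ∸ 4) * catalan (2 ^ (ℓ ∸ i ∸ 1) ∸ 1)) ^ (2 ^ i))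

Zballot : ℕ → ℤ
Zballot ℓ =
  (+ (2 ^ ℓ ∸ 7))
  ℤ.* ((+ ((2 ^ ℓ ∸ 6) C (2 ^ (ℓ ∸ 1) ∸ 3))) ℤ.- (+ ((2 ^ ℓ ∸ 6) C (2 ^ (ℓ ∸ 1) ∸ 6))))
  ℤ.* (+ (10 ^ (2 ^ (ℓ ∸ 3))
         * prodRange 0 (ℓ ∸ 4)
             (λ i → ((2 ^ (ℓ ∸ 1 ∸ i) ∸ 4) * catalan (2 ^ (ℓ ∸ i ∸ 2) ∸ 1)) ^ (2 ^ (suc i)))))

-- Both inequalities reduce to comparing single factors.  Z_zigzag and T_zigzag share every factor except
-- γ_ℓ versus β_ℓ, which have the same zigzag number, binomials C(N − 2, ℓ) ≤ C(N, ℓ), and multinomials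
-- whose top index drops by 2 while two parts a, b drop by 1; the latter ratio (M + 2)(M + 1)/((a + 1)(b + 1))
-- exceeds 1 because a + b ≤ M.  Z_ballot and T_ballot share the factor W = 10^(2^(ℓ−3)) ∏ …, and with
-- n = 2^(ℓ−1) − 3 what remains is (2n − 1)(C(2n, n) − C(2n, n − 3)) < (2n + 2) Cat(n + 2); expressing each
-- term as a rational multiple of C(2n, n) turns this into a cubic polynomial inequality in n.

module Submission where

open import Defs
open import Data.Nat using (ℕ; _≤_; _<_)
open import Data.Integer using (+_) renaming (_<_ to _<ℤ_)
open import Data.Product using (_×_)

open import Data.Nat
open import Data.Nat.Properties
open import Data.Nat.DivMod using (_/_; m/n*n≡m; m*n/n≡m; m/n*n≤m; /-monoˡ-≤)
open import Data.Nat.Combinatorics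
  using (_C_; nCk≡n!/k![n-k]!; k![n∸k]!∣n!; nCk+nC[k+1]≡[n+1]C[k+1])
open import Data.Nat.ListAction using (sum; product)
open import Data.Nat.ListAction.Properties using (product≢0)
open import Data.Nat.Tactic.RingSolver using (solve-∀)
import Data.Integer as ℤ
import Data.Integer.Properties as ℤ
import Data.Integer.Tactic.RingSolver as ℤ-Solver
open import Data.Bool using (true; false; T)
open import Data.Bool.Properties using (T-∧)
open import Data.Empty using (⊥-elim)
open import Data.Unit using (tt)
open import Data.Product using (_,_)
open import Data.List using (List; []; _∷_; map; upTo; applyUpTo)
open import Data.List.Properties using (map-upTo; map-applyUpTo; map-cong)
open import Data.List.Membership.Propositional using (_∈_; lose)
open import Data.List.Membership.Propositional.Properties using (∈-concatMap⁺)
open import Data.List.Relation.Unary.Any using (here; there)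
open import Data.List.Relation.Unary.All using (All; []; _∷_)
import Data.List.Relation.Unary.All.Properties as All
open import Data.List.Relation.Unary.AllPairs using (AllPairs; []; _∷_)
import Data.List.Relation.Unary.AllPairs.Properties as AllPairs
open import Function using (_∘_; Equivalence)
open import Relation.Binary.PropositionalEquality

-- Binomial and multinomial coefficients

nCk*k![n∸k]!≡n! : ∀ {n k} → k ≤ n → (n C k) * (k ! * (n ∸ k) !) ≡ n !
nCk*k![n∸k]!≡n! {n} {k} k≤n = begin
  (n C k) * (k ! * (n ∸ k) !)                   ≡⟨ cong (_* (k ! * (n ∸ k) !)) (nCk≡n!/k![n-k]! k≤n) ⟩
  (n ! / (k ! * (n ∸ k) !)) * (k ! * (n ∸ k) !) ≡⟨ m/n*n≡m (k![n∸k]!∣n! k≤n) ⟩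
  n !                                           ∎
  where
  open ≡-Reasoning
  instance _ = k !* (n ∸ k) !≢0

nCa*a!b!≡n! : ∀ {n} a b → a + b ≡ n → (n C a) * (a ! * b !) ≡ n !
nCa*a!b!≡n! a b refl =
  subst (λ c → ((a + b) C a) * (a ! * c !) ≡ (a + b) !) (m+n∸m≡n a b) (nCk*k![n∸k]!≡n! (m≤m+n a b))

0<nCa : ∀ {n} a b → a + b ≡ n → 0 < n C a
0<nCa {n} a b a+b≡n = >-nonZero⁻¹ (n C a) {{m*n≢0⇒m≢0 (n C a) {{nz}}}}
  where
  nz : NonZero ((n C a) * (a ! * b !))
  nz = subst NonZero (sym (nCa*a!b!≡n! a b a+b≡n)) (n !≢0)

nCk≤[1+n]Ck : ∀ n k → n C k ≤ suc n C k
nCk≤[1+n]Ck n zero    = ≤-refl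
nCk≤[1+n]Ck n (suc k) = subst (n C suc k ≤_) (nCk+nC[k+1]≡[n+1]C[k+1] n k) (m≤n+m (n C suc k) (n C k))

a!b!≤[a+b]! : ∀ a b → a ! * b ! ≤ (a + b) !
a!b!≤[a+b]! a b = begin
  a ! * b !                   ≤⟨ m≤n*m (a ! * b !) ((a + b) C a) {{>-nonZero (0<nCa a b refl)}} ⟩
  ((a + b) C a) * (a ! * b !) ≡⟨ nCa*a!b!≡n! a b refl ⟩
  (a + b) !                   ∎
  where open ≤-Reasoning

prodFact≤sum! : ∀ ks → prodFact ks ≤ sum ks !
prodFact≤sum! []       = ≤-refl
prodFact≤sum! (k ∷ ks) = ≤-trans (*-monoʳ-≤ (k !) (prodFact≤sum! ks)) (a!b!≤[a+b]! k (sum ks))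

m*n≤o⇒m≤o/n : ∀ m n o .{{_ : NonZero n}} → m * n ≤ o → m ≤ o / n
m*n≤o⇒m≤o/n m n o m*n≤o = subst (_≤ o / n) (m*n/n≡m m n) (/-monoˡ-≤ n m*n≤o)

2[1+a][1+b]≤[2+M][1+M] : ∀ {M} a b → a + b ≤ M → 2 * (suc a * suc b) ≤ (2 + M) * (1 + M)
2[1+a][1+b]≤[2+M][1+M] {M} a b a+b≤M = begin
  2 * (suc a * suc b)                                   ≤⟨ m≤m+n _ _ ⟩
  2 * (suc a * suc b) + (a * suc a + b * suc b)         ≡⟨ expand a b ⟩
  (2 + (a + b)) * (1 + (a + b))                         ≤⟨ *-mono-≤ (+-monoʳ-≤ 2 a+b≤M) (+-monoʳ-≤ 1 a+b≤M) ⟩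
  (2 + M) * (1 + M)                                     ∎
  where
  open ≤-Reasoning
  expand : ∀ a b → 2 * (suc a * suc b) + (a * suc a + b * suc b) ≡ (2 + (a + b)) * (1 + (a + b))
  expand = solve-∀

-- multinomial uses truncating division, so instead of the exact ratio we show (q + 1)·D′ ≤ (M + 2)! for the
-- old value q ≥ 1, via (q + 1)(a + 1)(b + 1) ≤ 2q(a + 1)(b + 1) ≤ (M + 2)(M + 1)q.
multinomial-< : ∀ {M} a b ts → sum (a ∷ b ∷ ts) ≡ M →
  multinomial M (a ∷ b ∷ ts) < multinomial (2 + M) (suc a ∷ suc b ∷ ts)
multinomial-< {M} a b ts refl =
  m*n≤o⇒m≤o/n (suc q) D′ ((2 + M) !) {{prodFact≢0 (suc a ∷ suc b ∷ ts)}} (begin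
    suc q * D′                                 ≡⟨ regroup q (suc a) (suc b) (a !) (b !) (prodFact ts) ⟩
    suc q * (suc a * suc b) * D                ≤⟨ *-monoˡ-≤ D (*-monoˡ-≤ (suc a * suc b) (+-monoˡ-≤ q 1≤q)) ⟩
    (q + q) * (suc a * suc b) * D              ≡⟨ double q (suc a * suc b) D ⟩
    (2 * (suc a * suc b)) * (q * D)            ≤⟨ *-mono-≤ (2[1+a][1+b]≤[2+M][1+M] a b a+b≤M) (m/n*n≤m (M !) D) ⟩
    (2 + M) * (1 + M) * M !                    ≡⟨ *-assoc (2 + M) (1 + M) (M !) ⟩
    (2 + M) !                                  ∎)
  where
  open ≤-Reasoning
  D  = prodFact (a ∷ b ∷ ts)
  D′ = prodFact (suc a ∷ suc b ∷ ts)
  instance _ = prodFact≢0 (a ∷ b ∷ ts)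
  q = M ! / D
  1≤q : 1 ≤ q
  1≤q = m*n≤o⇒m≤o/n 1 D (M !) (≤-trans (≤-reflexive (*-identityˡ D)) (prodFact≤sum! (a ∷ b ∷ ts)))
  a+b≤M : a + b ≤ M
  a+b≤M = ≤-trans (m≤m+n (a + b) (sum ts)) (≤-reflexive (+-assoc a b (sum ts)))
  regroup : ∀ q x y u v p → suc q * ((x * u) * ((y * v) * p)) ≡ suc q * (x * y) * (u * (v * p))
  regroup = solve-∀
  double : ∀ q z d → (q + q) * z * d ≡ (2 * z) * (q * d)
  double = solve-∀

-- Ratios of binomial coefficients and Catalan numbers

nC[1+a]*[1+a]≡nCa*[1+b] : ∀ {n} a b → a + suc b ≡ n → (n C suc a) * suc a ≡ (n C a) * suc b
nC[1+a]*[1+a]≡nCa*[1+b] {n} a b a+1+b≡n =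
  *-cancelʳ-≡ _ _ (a ! * b !) {{m*n≢0 (a !) (b !) {{a !≢0}} {{b !≢0}}}} (begin
    (n C suc a) * suc a * (a ! * b !) ≡⟨ regroup (n C suc a) (suc a) (a !) (b !) ⟩
    (n C suc a) * (suc a ! * b !)     ≡⟨ nCa*a!b!≡n! (suc a) b (trans (sym (+-suc a b)) a+1+b≡n) ⟩
    n !                               ≡⟨ nCa*a!b!≡n! a (suc b) a+1+b≡n ⟨
    (n C a) * (a ! * suc b !)         ≡⟨ regroup′ (n C a) (suc b) (a !) (b !) ⟩
    (n C a) * suc b * (a ! * b !)     ∎)
  where
  open ≡-Reasoning
  regroup : ∀ c x u v → c * x * (u * v) ≡ c * (x * u * v)
  regroup = solve-∀
  regroup′ : ∀ c y u v → c * (u * (y * v)) ≡ c * y * (u * v)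
  regroup′ = solve-∀

catalan*[1+n]≡[2n]Cn : ∀ n → catalan n * suc n ≡ (2 * n) C n
catalan*[1+n]≡[2n]Cn zero        = refl
catalan*[1+n]≡[2n]Cn n@(suc n-1) = begin
  (central / suc n) * suc n                    ≡⟨ cong (λ c → (c / suc n) * suc n) central≡ ⟨
  (((central ∸ next) * suc n) / suc n) * suc n ≡⟨ cong (_* suc n) (m*n/n≡m (central ∸ next) (suc n)) ⟩
  (central ∸ next) * suc n                     ≡⟨ central≡ ⟩
  central                                      ∎
  where
  open ≡-Reasoning
  central = (2 * n) C n
  next    = (2 * n) C suc n
  next*[1+n] : next * suc n ≡ central * n
  next*[1+n] = nC[1+a]*[1+a]≡nCa*[1+b] n n-1 ([1+m]+[1+m] n-1)
    where
    [1+m]+[1+m] : ∀ m → suc m + suc m ≡ 2 * suc m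
    [1+m]+[1+m] = solve-∀
  central≡ : (central ∸ next) * suc n ≡ central
  central≡ = begin
    (central ∸ next) * suc n            ≡⟨ *-distribʳ-∸ (suc n) central next ⟩
    central * suc n ∸ next * suc n      ≡⟨ cong₂ _∸_ (*-suc central n) next*[1+n] ⟩
    central + central * n ∸ central * n ≡⟨ m+n∸n≡m central (central * n) ⟩
    central                             ∎

0<catalan : ∀ n → 0 < catalan n
0<catalan n = *-cancelʳ-< (suc n) 0 (catalan n)
  (subst (0 <_) (sym (catalan*[1+n]≡[2n]Cn n)) (0<nCa n n (n+n≡2*n n)))
  where
  n+n≡2*n : ∀ n → n + n ≡ 2 * n
  n+n≡2*n = solve-∀

[2+2n]C[1+n]*[1+n]≡2[1+2n]*[2n]Cn : ∀ n → ((2 * suc n) C suc n) * suc n ≡ 2 * (1 + 2 * n) * ((2 * n) C n)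
[2+2n]C[1+n]*[1+n]≡2[1+2n]*[2n]Cn n =
  *-cancelʳ-≡ _ _ (n ! * suc n !) {{m*n≢0 (n !) (suc n !) {{n !≢0}} {{suc n !≢0}}}} (begin
    ((2 * suc n) C suc n) * suc n * (n ! * suc n !)             ≡⟨ regroup ((2 * suc n) C suc n) (suc n) (n !) ⟩
    ((2 * suc n) C suc n) * (suc n ! * suc n !)                 ≡⟨ nCa*a!b!≡n! (suc n) (suc n) (double (suc n)) ⟩
    (2 * suc n) !                                               ≡⟨ cong _! (2*[1+n]≡2+2*n n) ⟩
    (2 + 2 * n) * ((1 + 2 * n) * (2 * n) !)                     ≡⟨ cong (λ f → (2 + 2 * n) * ((1 + 2 * n) * f)) (nCa*a!b!≡n! n n (double n)) ⟨
    (2 + 2 * n) * ((1 + 2 * n) * (((2 * n) C n) * (n ! * n !))) ≡⟨ regroup′ n ((2 * n) C n) (n !) ⟩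
    2 * (1 + 2 * n) * ((2 * n) C n) * (n ! * suc n !)           ∎)
  where
  open ≡-Reasoning
  double : ∀ n → n + n ≡ 2 * n
  double = solve-∀
  2*[1+n]≡2+2*n : ∀ n → 2 * suc n ≡ 2 + 2 * n
  2*[1+n]≡2+2*n = solve-∀
  regroup : ∀ c x f → c * x * (f * (x * f)) ≡ c * ((x * f) * (x * f))
  regroup = solve-∀
  regroup′ : ∀ n c f → (2 + 2 * n) * ((1 + 2 * n) * (c * (f * f))) ≡ 2 * (1 + 2 * n) * c * (f * (suc n * f))
  regroup′ = solve-∀

nCa*[1+b][2+b][3+b]≡nC[3+a]*[1+a][2+a][3+a] : ∀ {n} a b → a + (3 + b) ≡ n →
  (n C a) * ((1 + b) * (2 + b) * (3 + b)) ≡ (n C (3 + a)) * ((1 + a) * (2 + a) * (3 + a))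
nCa*[1+b][2+b][3+b]≡nC[3+a]*[1+a][2+a][3+a] {n} a b a+3+b≡n =
  *-cancelʳ-≡ _ _ (a ! * b !) {{m*n≢0 (a !) (b !) {{a !≢0}} {{b !≢0}}}} (begin
    (n C a) * ((1 + b) * (2 + b) * (3 + b)) * (a ! * b !)       ≡⟨ regroup (n C a) b (a !) (b !) ⟩
    (n C a) * (a ! * (3 + b) !)                                 ≡⟨ nCa*a!b!≡n! a (3 + b) a+3+b≡n ⟩
    n !                                                         ≡⟨ nCa*a!b!≡n! (3 + a) b (trans (swap a b) a+3+b≡n) ⟨
    (n C (3 + a)) * ((3 + a) ! * b !)                           ≡⟨ regroup′ (n C (3 + a)) a (a !) (b !) ⟩
    (n C (3 + a)) * ((1 + a) * (2 + a) * (3 + a)) * (a ! * b !) ∎)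
  where
  open ≡-Reasoning
  regroup : ∀ c b u v → c * ((1 + b) * (2 + b) * (3 + b)) * (u * v) ≡ c * (u * ((3 + b) * ((2 + b) * ((1 + b) * v))))
  regroup = solve-∀
  regroup′ : ∀ c a u v → c * ((3 + a) * ((2 + a) * ((1 + a) * u)) * v) ≡ c * ((1 + a) * (2 + a) * (3 + a)) * (u * v)
  regroup′ = solve-∀
  swap : ∀ a b → 3 + a + b ≡ a + (3 + b)
  swap = solve-∀

-- Zigzag numbers are positive

swapPairs : List ℕ → List ℕ
swapPairs []           = []
swapPairs (x ∷ [])     = x ∷ []
swapPairs (x ∷ y ∷ xs) = y ∷ x ∷ swapPairs xs

-- For increasing xs this is the up-down permutation x₁ < x₃ > x₂ < x₅ > x₄ < ⋯ of xs.
alternating : List ℕ → List ℕ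
alternating []       = []
alternating (x ∷ xs) = x ∷ swapPairs xs

x∷w∈insertions : ∀ x w → x ∷ w ∈ insertions x w
x∷w∈insertions x []      = here refl
x∷w∈insertions x (_ ∷ _) = here refl

y∷x∷w∈insertions : ∀ x y w → y ∷ x ∷ w ∈ insertions x (y ∷ w)
y∷x∷w∈insertions x y []      = there (here refl)
y∷x∷w∈insertions x y (_ ∷ _) = there (here refl)

∈-insertions⇒∈-perms : ∀ x xs {v w} → v ∈ perms xs → w ∈ insertions x v → w ∈ perms (x ∷ xs)
∈-insertions⇒∈-perms x xs v∈perms w∈insertions =
  ∈-concatMap⁺ (insertions x) {xs = perms xs} (lose v∈perms w∈insertions)

swapPairs∈perms : ∀ xs → swapPairs xs ∈ perms xs
swapPairs∈perms []           = here refl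
swapPairs∈perms (x ∷ [])     = here refl
swapPairs∈perms (x ∷ y ∷ xs) = ∈-insertions⇒∈-perms x (y ∷ xs)
  (∈-insertions⇒∈-perms y xs (swapPairs∈perms xs) (x∷w∈insertions y (swapPairs xs)))
  (y∷x∷w∈insertions x y (swapPairs xs))

alternating∈perms : ∀ xs → alternating xs ∈ perms xs
alternating∈perms []       = here refl
alternating∈perms (x ∷ xs) = ∈-insertions⇒∈-perms x xs (swapPairs∈perms xs) (x∷w∈insertions x (swapPairs xs))

upDown-∷-swapPairs : ∀ {x xs} → All (x <_) xs → AllPairs _<_ xs → T (upDown (x ∷ swapPairs xs))
upDown-∷-swapPairs []            []                        = tt
upDown-∷-swapPairs (x<y ∷ [])    _                         = Equivalence.from T-∧ (<⇒<ᵇ x<y , tt)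
upDown-∷-swapPairs (_ ∷ x<z ∷ _) ((y<z ∷ y<r) ∷ (_ ∷ r↑)) =
  Equivalence.from T-∧ (<⇒<ᵇ x<z , Equivalence.from T-∧ (<⇒<ᵇ y<z , upDown-∷-swapPairs y<r r↑))

alternating-isUpDown : ∀ {xs} → AllPairs _<_ xs → T (isUpDown (alternating xs))
alternating-isUpDown []           = tt
alternating-isUpDown (x<xs ∷ xs↑) = upDown-∷-swapPairs x<xs xs↑

0<countTrue : ∀ p {x} xs → x ∈ xs → T (p x) → 0 < countTrue p xs
0<countTrue p (y ∷ ys) x∈ px with p y in py
... | true  = z<s
... | false with x∈
...   | here refl = ⊥-elim (subst T py px)
...   | there x∈ys = 0<countTrue p ys x∈ys px

oneTo-increasing : ∀ n → AllPairs _<_ (oneTo n)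
oneTo-increasing n =
  subst (AllPairs _<_) (sym (map-upTo suc n)) (AllPairs.applyUpTo⁺₁ suc n (λ i<j _ → s<s i<j))

0<zigzag : ∀ n → 0 < zigzag n
0<zigzag n = 0<countTrue isUpDown (perms (oneTo n))
  (alternating∈perms (oneTo n)) (alternating-isUpDown (oneTo-increasing n))

-- The zigzag inequality

sum-2^[n∸j]∸1 : ∀ n → sum (applyUpTo (λ j → 2 ^ (n ∸ j) ∸ 1) n) + (n + 2) ≡ 2 ^ suc n
sum-2^[n∸j]∸1 zero    = refl
sum-2^[n∸j]∸1 (suc n) = begin
  (2 ^ suc n ∸ 1 + s) + (suc n + 2)   ≡⟨ regroup (2 ^ suc n ∸ 1) s n ⟩
  (2 ^ suc n ∸ 1 + 1) + (s + (n + 2)) ≡⟨ cong₂ _+_ (m∸n+n≡m (m^n>0 2 (suc n))) (sum-2^[n∸j]∸1 n) ⟩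
  2 ^ suc n + 2 ^ suc n               ≡⟨ cong (_+_ (2 ^ suc n)) (+-identityʳ (2 ^ suc n)) ⟨
  2 ^ suc (suc n)                     ∎
  where
  open ≡-Reasoning
  s = sum (applyUpTo (λ j → 2 ^ (n ∸ j) ∸ 1) n)
  regroup : ∀ t s n → (t + s) + (suc n + 2) ≡ (t + 1) + (s + (n + 2))
  regroup = solve-∀

product-map-upTo≢0 : ∀ (f : ℕ → ℕ) n → (∀ {i} → i < n → NonZero (f i)) → NonZero (product (map f (upTo n)))
product-map-upTo≢0 f n f≢0 = product≢0 (subst (All NonZero) (sym (map-upTo f n)) (All.applyUpTo⁺₁ f n f≢0))

zigzagTerm : ℕ → ℕ → ℕ → ℕ → ℕ → ℕ
zigzagTerm ℓ N M a b = zigzag ℓ * (N C ℓ) * multinomial M (a ∷ b ∷ tailParts ℓ)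

zigzagTerm-cong : ∀ ℓ {N N′ M M′ a a′ b b′} → N ≡ N′ → M ≡ M′ → a ≡ a′ → b ≡ b′ →
  zigzagTerm ℓ N M a b ≡ zigzagTerm ℓ N′ M′ a′ b′
zigzagTerm-cong ℓ refl refl refl refl = refl

zigzagTerm-< : ∀ ℓ {N M} a b → ℓ ≤ N → sum (a ∷ b ∷ tailParts ℓ) ≡ M →
  zigzagTerm ℓ N M a b < zigzagTerm ℓ (2 + N) (2 + M) (suc a) (suc b)
zigzagTerm-< ℓ {N} {M} a b ℓ≤N sum≡M = ≤-<-trans
  (*-monoˡ-≤ (multinomial M (a ∷ b ∷ tailParts ℓ))
    (*-monoʳ-≤ (zigzag ℓ) (≤-trans (nCk≤[1+n]Ck N ℓ) (nCk≤[1+n]Ck (suc N) ℓ))))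
  (*-monoʳ-< (zigzag ℓ * ((2 + N) C ℓ)) {{m*n≢0 _ _ {{>-nonZero (0<zigzag ℓ)}} {{>-nonZero 0<C}}}}
    (multinomial-< a b (tailParts ℓ) sum≡M))
  where
  0<C : 0 < (2 + N) C ℓ
  0<C = 0<nCa ℓ (2 + N ∸ ℓ) (m+[n∸m]≡n (m≤n⇒m≤o+n 2 ℓ≤N))

γ<β : ∀ k → γ (4 + k) < β (4 + k)
γ<β k = subst (γ ℓ <_) (sym β≡) (zigzagTerm-< ℓ (2 ^ (ℓ ∸ 1) ∸ 3) (2 ^ (ℓ ∸ 2) ∸ 3) ℓ≤N sum≡M)
  where
  -- Writing 2^(ℓ−2) = 3 + y makes every truncated subtraction in β ℓ and γ ℓ compute.
  open ≡-Reasoning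
  ℓ = 4 + k
  S = sum (tailParts ℓ)
  y = S + k
  2^[ℓ∸2]≡3+y : 2 ^ (ℓ ∸ 2) ≡ 3 + y
  2^[ℓ∸2]≡3+y = begin
    2 ^ (ℓ ∸ 2)                                                  ≡⟨ sum-2^[n∸j]∸1 (suc k) ⟨
    sum (applyUpTo (λ j → 2 ^ (suc k ∸ j) ∸ 1) (suc k)) + (suc k + 2) ≡⟨ cong (λ xs → sum xs + (suc k + 2)) (map-upTo _ (suc k)) ⟨
    S + (suc k + 2)                                              ≡⟨ regroup S k ⟩
    3 + y                                                        ∎
    where
    regroup : ∀ S k → S + (suc k + 2) ≡ 3 + (S + k)
    regroup = solve-∀
  2^[ℓ∸1]≡6+2y : 2 ^ (ℓ ∸ 1) ≡ 6 + 2 * y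
  2^[ℓ∸1]≡6+2y = trans (cong (2 *_) 2^[ℓ∸2]≡3+y) (double y)
    where
    double : ∀ y → 2 * (3 + y) ≡ 6 + 2 * y
    double = solve-∀
  2^ℓ≡12+4y : 2 ^ ℓ ≡ 12 + 4 * y
  2^ℓ≡12+4y = trans (cong (2 *_) 2^[ℓ∸1]≡6+2y) (double y)
    where
    double : ∀ y → 2 * (6 + 2 * y) ≡ 12 + 4 * y
    double = solve-∀
  L = 3 + 2 * y + (y + S)
  L+ℓ≡7+4y : L + ℓ ≡ 7 + 4 * y
  L+ℓ≡7+4y = regroup S k
    where
    regroup : ∀ S k → 3 + 2 * (S + k) + ((S + k) + S) + (4 + k) ≡ 7 + 4 * (S + k)
    regroup = solve-∀
  ℓ≤7+4y : ℓ ≤ 7 + 4 * y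
  ℓ≤7+4y = subst (ℓ ≤_) L+ℓ≡7+4y (m≤n+m ℓ L)
  ℓ≤N : ℓ ≤ 2 ^ ℓ ∸ 5
  ℓ≤N rewrite 2^ℓ≡12+4y = ℓ≤7+4y
  sum≡M : sum ((2 ^ (ℓ ∸ 1) ∸ 3) ∷ (2 ^ (ℓ ∸ 2) ∸ 3) ∷ tailParts ℓ) ≡ 2 ^ ℓ ∸ 5 ∸ ℓ
  sum≡M rewrite 2^ℓ≡12+4y | 2^[ℓ∸1]≡6+2y | 2^[ℓ∸2]≡3+y = trans (sym (m+n∸n≡m L ℓ)) (cong (_∸ ℓ) L+ℓ≡7+4y)
  β≡ : β ℓ ≡ zigzagTerm ℓ (2 + (2 ^ ℓ ∸ 5)) (2 + (2 ^ ℓ ∸ 5 ∸ ℓ)) (suc (2 ^ (ℓ ∸ 1) ∸ 3)) (suc (2 ^ (ℓ ∸ 2) ∸ 3))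
  β≡ = zigzagTerm-cong ℓ N≡ M≡ a≡ b≡
    where
    N≡ : 2 ^ ℓ ∸ 3 ≡ 2 + (2 ^ ℓ ∸ 5)
    N≡ rewrite 2^ℓ≡12+4y = refl
    M≡ : 2 ^ ℓ ∸ 3 ∸ ℓ ≡ 2 + (2 ^ ℓ ∸ 5 ∸ ℓ)
    M≡ rewrite 2^ℓ≡12+4y = +-∸-assoc 2 ℓ≤7+4y
    a≡ : 2 ^ (ℓ ∸ 1) ∸ 2 ≡ suc (2 ^ (ℓ ∸ 1) ∸ 3)
    a≡ rewrite 2^[ℓ∸1]≡6+2y = refl
    b≡ : 2 ^ (ℓ ∸ 2) ∸ 2 ≡ suc (2 ^ (ℓ ∸ 2) ∸ 3)
    b≡ rewrite 2^[ℓ∸2]≡3+y = refl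

Zzigzag<Tzigzag : ∀ k → Zzigzag (4 + k) < Tzigzag (4 + k)
Zzigzag<Tzigzag k = *-monoˡ-< (βprod (4 + k)) {{βprod≢0}} (*-monoʳ-< (10 ^ 2 ^ k) {{m^n≢0 10 (2 ^ k)}} (γ<β k))
  where
  β≢0 : ∀ j → NonZero (β (4 + j))
  β≢0 j = >-nonZero (≤-<-trans z≤n (γ<β j))
  βprod≢0 : NonZero (βprod (4 + k))
  βprod≢0 = product-map-upTo≢0 _ k (λ {j} _ → m^n≢0 (β (4 + j)) (2 ^ (k ∸ suc j)) {{β≢0 j}})

-- The ballot inequality

-- With n = 3 + m this reads (2n − 1)·C(2n, n) < (2n + 2)·Cat(n + 2) + (2n − 1)·C(2n, n − 3).
ballot-core : ∀ m →
  (5 + 2 * m) * ((6 + 2 * m) C (3 + m)) < (8 + 2 * m) * catalan (5 + m) + (5 + 2 * m) * ((6 + 2 * m) C m)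
ballot-core m = *-cancelʳ-< Q (a * B) (b * c + a * D) (begin-strict
  a * B * Q                    ≡⟨ *-comm-middle a B Q ⟩
  B * (a * Q)                  <⟨ *-monoʳ-< B {{>-nonZero 0<B}} polynomial ⟩
  B * (b * K + a * E)          ≡⟨ distribute B b K a E ⟩
  b * (K * B) + a * (B * E)    ≡⟨ cong₂ (λ x y → b * x + a * y) c*Q≡K*B D*Q≡B*E ⟨
  b * (c * Q) + a * (D * Q)    ≡⟨ collect b c Q a D ⟩
  (b * c + a * D) * Q          ∎)
  where
  open ≤-Reasoning
  a = 5 + 2 * m
  b = 8 + 2 * m
  c = catalan (5 + m)
  B = (6 + 2 * m) C (3 + m)
  D = (6 + 2 * m) C m
  Q = (4 + m) * (5 + m) * (6 + m)
  E = (1 + m) * (2 + m) * (3 + m)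
  κ₃ = 2 * (1 + 2 * (3 + m))
  κ₄ = 2 * (1 + 2 * (4 + m))
  K = κ₄ * κ₃
  0<B : 0 < B
  0<B = 0<nCa (3 + m) (3 + m) ([3+m]+[3+m] m)
    where
    [3+m]+[3+m] : ∀ m → (3 + m) + (3 + m) ≡ 6 + 2 * m
    [3+m]+[3+m] = solve-∀
  D*Q≡B*E : D * Q ≡ B * E
  D*Q≡B*E = nCa*[1+b][2+b][3+b]≡nC[3+a]*[1+a][2+a][3+a] m (3 + m) (m+[6+m] m)
    where
    m+[6+m] : ∀ m → m + (3 + (3 + m)) ≡ 6 + 2 * m
    m+[6+m] = solve-∀
  c*Q≡K*B : c * Q ≡ K * B
  c*Q≡K*B = begin-equality
    c * Q                                           ≡⟨ regroup c m ⟩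
    c * (6 + m) * (5 + m) * (4 + m)                 ≡⟨ cong (λ x → x * (5 + m) * (4 + m)) (catalan*[1+n]≡[2n]Cn (5 + m)) ⟩
    ((2 * (5 + m)) C (5 + m)) * (5 + m) * (4 + m)   ≡⟨ cong (_* (4 + m)) ([2+2n]C[1+n]*[1+n]≡2[1+2n]*[2n]Cn (4 + m)) ⟩
    κ₄ * ((2 * (4 + m)) C (4 + m)) * (4 + m)        ≡⟨ *-assoc κ₄ ((2 * (4 + m)) C (4 + m)) (4 + m) ⟩
    κ₄ * (((2 * (4 + m)) C (4 + m)) * (4 + m))      ≡⟨ cong (κ₄ *_) ([2+2n]C[1+n]*[1+n]≡2[1+2n]*[2n]Cn (3 + m)) ⟩
    κ₄ * (κ₃ * ((2 * (3 + m)) C (3 + m)))           ≡⟨ cong (λ n → κ₄ * (κ₃ * (n C (3 + m)))) (2*[3+m] m) ⟩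
    κ₄ * (κ₃ * B)                                   ≡⟨ *-assoc κ₄ κ₃ B ⟨
    K * B                                           ∎
    where
    regroup : ∀ c m → c * ((4 + m) * (5 + m) * (6 + m)) ≡ c * (6 + m) * (5 + m) * (4 + m)
    regroup = solve-∀
    2*[3+m] : ∀ m → 2 * (3 + m) ≡ 6 + 2 * m
    2*[3+m] = solve-∀
  gap : ∀ m → (8 + 2 * m) * (2 * (1 + 2 * (4 + m)) * (2 * (1 + 2 * (3 + m)))) + (5 + 2 * m) * ((1 + m) * (2 + m) * (3 + m))
            ≡ suc ((5 + 2 * m) * ((4 + m) * (5 + m) * (6 + m)) + (1445 + m * (985 + m * (213 + 14 * m))))
  gap = solve-∀
  polynomial : a * Q < b * K + a * E
  polynomial = subst (a * Q <_) (sym (gap m)) (s≤s (m≤m+n (a * Q) _))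
  *-comm-middle : ∀ a B Q → a * B * Q ≡ B * (a * Q)
  *-comm-middle = solve-∀
  distribute : ∀ B b K a E → B * (b * K + a * E) ≡ b * (K * B) + a * (B * E)
  distribute = solve-∀
  collect : ∀ b c Q a D → b * (c * Q) + a * (D * Q) ≡ (b * c + a * D) * Q
  collect = solve-∀

+a*[+b-+c]<+d : ∀ a b c d → a * b < d + a * c → + a ℤ.* (+ b ℤ.- + c) <ℤ + d
+a*[+b-+c]<+d a b c d ab<d+ac = begin-strict
  + a ℤ.* (+ b ℤ.- + c)          ≡⟨ distrib (+ a) (+ b) (+ c) ⟩
  + a ℤ.* + b ℤ.- + a ℤ.* + c    ≡⟨ cong₂ ℤ._-_ (ℤ.pos-* a b) (ℤ.pos-* a c) ⟨
  + (a * b) ℤ.- + (a * c)        ≡⟨ ℤ.[+m]-[+n]≡m⊖n (a * b) (a * c) ⟩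
  (a * b) ℤ.⊖ (a * c)            <⟨ ℤ.⊖-monoˡ-< (a * c) ab<d+ac ⟩
  (d + a * c) ℤ.⊖ (a * c)        ≡⟨ ℤ.≤-⊖ (m≤n+m (a * c) d) ⟩
  + (d + a * c ∸ a * c)          ≡⟨ cong +_ (m+n∸n≡m d (a * c)) ⟩
  + d                            ∎
  where
  open ℤ.≤-Reasoning
  distrib : ∀ (a b c : ℤ.ℤ) → a ℤ.* (b ℤ.- c) ≡ a ℤ.* b ℤ.- a ℤ.* c
  distrib = ℤ-Solver.solve-∀

m∸[1+n]∸1≡m∸n∸2 : ∀ m n → m ∸ suc n ∸ 1 ≡ m ∸ n ∸ 2
m∸[1+n]∸1≡m∸n∸2 m n = begin
  m ∸ suc n ∸ 1     ≡⟨ ∸-+-assoc m (suc n) 1 ⟩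
  m ∸ suc (n + 1)   ≡⟨ cong (m ∸_) (+-suc n 1) ⟨
  m ∸ (n + 2)       ≡⟨ ∸-+-assoc m n 2 ⟨
  m ∸ n ∸ 2         ∎
  where open ≡-Reasoning

Zballot<Tballot : ∀ k → Zballot (4 + k) <ℤ + Tballot (4 + k)
Zballot<Tballot k = begin-strict
  Zballot ℓ                          ≡⟨⟩
  (+ a ℤ.* (+ B ℤ.- + D)) ℤ.* + W    <⟨ ℤ.*-monoʳ-<-pos (+ W) {{ℤ.positive (ℤ.+<+ (>-nonZero⁻¹ W))}} (+a*[+b-+c]<+d a B D f core) ⟩
  + f ℤ.* + W                        ≡⟨ ℤ.pos-* f W ⟨
  + (f * W)                          ≡⟨ cong +_ Tballot≡f*W ⟨
  + Tballot ℓ                        ∎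
  where
  open ℤ.≤-Reasoning
  ℓ = 4 + k
  x = 2 ^ (ℓ ∸ 1)
  m = x ∸ 6
  a = 2 ^ ℓ ∸ 7
  B = (2 ^ ℓ ∸ 6) C (x ∸ 3)
  D = (2 ^ ℓ ∸ 6) C (x ∸ 6)
  f = (2 ^ ℓ ∸ 4) * catalan (x ∸ 1)
  F : ℕ → ℕ
  F i = ((2 ^ (ℓ ∸ i) ∸ 4) * catalan (2 ^ (ℓ ∸ i ∸ 1) ∸ 1)) ^ (2 ^ i)
  G : ℕ → ℕ
  G i = ((2 ^ (ℓ ∸ 1 ∸ i) ∸ 4) * catalan (2 ^ (ℓ ∸ i ∸ 2) ∸ 1)) ^ (2 ^ suc i)
  W = 10 ^ 2 ^ (ℓ ∸ 3) * product (map G (upTo k))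

  x≡6+m : x ≡ 6 + m
  x≡6+m = sym (m+[n∸m]≡n (≤-trans (m≤m+n 6 2) (^-monoʳ-≤ 2 (m≤m+n 3 k))))
  2^ℓ≡12+2m : 2 ^ ℓ ≡ 12 + 2 * m
  2^ℓ≡12+2m = trans (cong (2 *_) x≡6+m) (double m)
    where
    double : ∀ m → 2 * (6 + m) ≡ 12 + 2 * m
    double = solve-∀
  core : a * B < f + a * D
  core = subst₂ (λ P x → (P ∸ 7) * ((P ∸ 6) C (x ∸ 3)) < (P ∸ 4) * catalan (x ∸ 1) + (P ∸ 7) * ((P ∸ 6) C (x ∸ 6)))
    (sym 2^ℓ≡12+2m) (sym x≡6+m) (ballot-core m)

  G≢0 : ∀ {i} → i < k → NonZero (G i)
  G≢0 {i} i<k = m^n≢0 ((2 ^ (ℓ ∸ 1 ∸ i) ∸ 4) * catalan c) (2 ^ suc i)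
    {{m*n≢0 _ _ {{>-nonZero (m<n⇒0<n∸m 4<2^j)}} {{>-nonZero (0<catalan c)}}}}
    where
    c = 2 ^ (ℓ ∸ i ∸ 2) ∸ 1
    4<2^j : 4 < 2 ^ (ℓ ∸ 1 ∸ i)
    4<2^j = ≤-trans (m≤m+n 5 3)
      (^-monoʳ-≤ 2 (subst (3 ≤_) (sym (+-∸-assoc 3 (<⇒≤ i<k))) (m≤m+n 3 (k ∸ i))))
  instance
    W≢0 : NonZero W
    W≢0 = m*n≢0 (10 ^ 2 ^ (ℓ ∸ 3)) (product (map G (upTo k))) {{m^n≢0 10 (2 ^ (ℓ ∸ 3))}} {{product-map-upTo≢0 G k G≢0}}

  F∘suc≗G : ∀ i → F (suc i) ≡ G i
  F∘suc≗G i = cong (λ e → ((2 ^ (ℓ ∸ suc i) ∸ 4) * catalan (2 ^ e ∸ 1)) ^ (2 ^ suc i)) (m∸[1+n]∸1≡m∸n∸2 ℓ i)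
  Tballot≡f*W : Tballot ℓ ≡ f * W
  Tballot≡f*W = trans
    (cong (λ ys → 10 ^ 2 ^ (ℓ ∸ 3) * ((f * 1) * product ys))
      (trans (map-applyUpTo suc F k) (trans (sym (map-upTo (F ∘ suc) k)) (map-cong F∘suc≗G (upTo k)))))
    (regroup (10 ^ 2 ^ (ℓ ∸ 3)) f (product (map G (upTo k))))
    where
    regroup : ∀ t f r → t * ((f * 1) * r) ≡ f * (t * r)
    regroup = solve-∀

mainTheorem11 : (ℓ : ℕ) → 4 ≤ ℓ →
    (Zzigzag ℓ < Tzigzag ℓ) × (Zballot ℓ <ℤ + Tballot ℓ)
mainTheorem11 _ (s≤s (s≤s (s≤s (s≤s {n = k} z≤n)))) = Zzigzag<Tzigzag k , Zballot<Tballot k
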